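{- (In ZF, i.e. without the Axiom of Choice.) For any sets $A$, $B$, $C$: if $A \ll C$ and $B \ll C$, then $A + B \ll C$.
   Context: All reasoning takes place in ZF without the Axiom of Choice. For sets $X,Y$, $X+Y$ denotes the disjoint union $(\{0\}\times X)\cup(\{1\}\times Y)$. We write $X \ll Z$ (equivalently $Z \gg X$, "$Z$ swallows $X$") if there is a bijection between $Z+X$ and $Z$. -}

module Defs where

open import Level using (Level; _⊔_)
open import Data.Sum using (_⊎_)
open import Function.Bundles using (_⤖_)

-- Sets are modelled as types. X + Y is the disjoint union X ⊎ Y
-- (inj₁ = tag 0, inj₂ = tag 1).
-- X ≪ Z  ("Z swallows X"): there is a bijection between Z + X and Z.
_≪_ : ∀ {x z : Level} → Set x → Set z → Set (x ⊔ z)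
X ≪ Z = (Z ⊎ X) ⤖ Z

infix 4 _≪_

module Submission where

open import Defs
open import Data.Sum using (_⊎_; inj₁; inj₂)
open import Data.Sum.Base using (assocʳ; assocˡ)
open import Data.Sum.Algebra using (⊎-cong)
open import Function.Bundles using (_↔_; mk↔ₛ′)
open import Function.Properties.Bijection using (⤖⇒↔)
open import Function.Properties.Inverse using (↔⇒⤖; ↔-refl; ↔-trans)
open import Relation.Binary.PropositionalEquality using (refl)

-- The library's ⊎-assoc requires all three summands to live in one universe.
⊎-assoc-↔ : ∀ {a b c} {A : Set a} {B : Set b} {C : Set c} →
            (A ⊎ (B ⊎ C)) ↔ ((A ⊎ B) ⊎ C)
⊎-assoc-↔ = mk↔ₛ′ assocˡ assocʳ
  (λ { (inj₁ (inj₁ _)) → refl ; (inj₁ (inj₂ _)) → refl ; (inj₂ _) → refl })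
  (λ { (inj₁ _) → refl ; (inj₂ (inj₁ _)) → refl ; (inj₂ (inj₂ _)) → refl })

-- C + (A + B) ≅ (C + A) + B ≅ C + B ≅ C.
lemma1 : ∀ {a b c} (A : Set a) (B : Set b) (C : Set c) →
           A ≪ C → B ≪ C → (A ⊎ B) ≪ C
lemma1 A B C C+A≅C C+B≅C =
  ↔⇒⤖ (↔-trans ⊎-assoc-↔
        (↔-trans (⊎-cong (⤖⇒↔ C+A≅C) ↔-refl)
                 (⤖⇒↔ C+B≅C)))
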